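{- For every positive integer $n$, the minimum order of a simple connected $(4n+1)$-regular graph having \textbf{rna} number one is $8n+6$.
   Context: All graphs are simple, connected and undirected. For a graph $G$ of order $N$, the \textbf{rna} number $\sigma^{ - }(G)$ is the minimum, over all bijections $f: V(G)\to\{1,2,\dots,N\}$, of the number of edges $uv$ of $G$ such that $f(u)$ and $f(v)$ have different parity. -}

module Defs where

open import Data.Bool using (Bool; true; false; if_then_else_; _∧_)
open import Data.Nat using (ℕ; zero; suc; _+_; _<?_; _%_; _≤_)
import Data.Nat as ℕ
open import Data.Fin using (Fin; toℕ)
open import Data.List using (List; map; allFin)
open import Data.Nat.ListAction using (sum)
open import Data.Product using (Σ; _×_; ∃)
open import Relation.Nullary using (does)
open import Relation.Binary.PropositionalEquality using (_≡_)
open import Function.Definitions using (Bijective)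

record Graph (N : ℕ) : Set where
  field
    adj    : Fin N → Fin N → Bool
    sym    : ∀ i j → adj i j ≡ adj j i
    irrefl : ∀ i → adj i i ≡ false
open Graph public

count : ∀ {N} → (Fin N → Bool) → ℕ
count {N} P = sum (map (λ i → if P i then 1 else 0) (allFin N))

degree : ∀ {N} → Graph N → Fin N → ℕ
degree G i = count (adj G i)

Regular : ∀ {N} → Graph N → ℕ → Set
Regular G d = ∀ i → degree G i ≡ d

data Reach {N} (G : Graph N) : Fin N → Fin N → Set where
  here : ∀ {i} → Reach G i i
  step : ∀ {i k j} → adj G i k ≡ true → Reach G k j → Reach G i j

Connected : ∀ {N} → Graph N → Set
Connected G = ∀ i j → Reach G i j

label : ∀ {N} → (Fin N → Fin N) → Fin N → ℕ
label f v = suc (toℕ (f v))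

diffParity : ∀ {N} → (Fin N → Fin N) → Fin N → Fin N → Bool
diffParity f u v = does ((label f u + label f v) % 2 ℕ.≟ 1)

oddEdges : ∀ {N} → Graph N → (Fin N → Fin N) → ℕ
oddEdges G f =
  sum (map (λ u → count (λ v → does (toℕ u <? toℕ v) ∧ adj G u v ∧ diffParity f u v))
           (allFin _))

Labelling : ℕ → Set
Labelling N = Σ (Fin N → Fin N) (Bijective _≡_ _≡_)

RnaNumber : ∀ {N} → Graph N → ℕ → Set
RnaNumber G k =
  (∃ λ (f : Labelling _) → oddEdges G (Data.Product.proj₁ f) ≡ k) ×
  (∀ (f : Labelling _) → k ≤ oddEdges G (Data.Product.proj₁ f))

-- If a labelling f has exactly one odd edge xy, let X be the set of vertices whose labels
-- have the parity of f(x); then xy is the only edge leaving X.  In a d-regular graph with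
-- d ≥ 2 this forces |X| ≥ d + 2: x has a neighbour z ∈ X, whose d neighbours all lie in
-- X ∖ {z}, so |X| ≥ d + 1; and if |X| = d + 1, every vertex of X ∖ {x} is adjacent to all
-- of X, so x has the d neighbours X ∖ {x} besides y.  Both parity classes are such sides,
-- hence N ≥ 2 (d + 2) = 8n + 6.
--
-- Conversely, the complement of P₃ ∪ 2n K₂ on 4n + 3 vertices is (4n + 1)-regular except
-- for the centre of P₃, of degree 4n.  Joining the centres of two copies gives a connected
-- (4n + 1)-regular graph of order 8n + 6; numbering one copy by odd and the other by even
-- labels leaves only the joining edge odd, and every labelling of a connected graph has an
-- odd edge.

module Submission where

open import Defs hiding (sym)
open import Data.Bool using (Bool; true; false; if_then_else_; not; _∧_)
open import Data.Bool.Properties using (∧-zeroʳ; ¬-not; T-≡)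
import Data.Bool.Properties as Bool
open import Data.Empty using (⊥; ⊥-elim)
open import Data.Fin using (Fin; toℕ; _≟_; fromℕ<; #_) renaming (zero to fz; suc to fs)
import Data.Fin.Properties as Finₚ
open import Data.List using (map; allFin; tabulate)
open import Data.List.Properties using (map-tabulate)
open import Data.Nat using (ℕ; zero; suc; _+_; _*_; _≤_; _<_; z≤n; s≤s; s≤s⁻¹; z<s;
                            _%_; _<?_; _<ᵇ_; _≡ᵇ_; ⌊_/2⌋; parity)
import Data.Nat as ℕ
import Data.Nat.ListAction as List
open import Data.Nat.Properties hiding (_≟_)
open import Data.Nat.Tactic.RingSolver using (solve-∀)
open import Data.Parity.Base as ℙ using (Parity; 0ℙ; 1ℙ)
import Data.Parity.Properties as ℙ
open import Data.Product using (Σ; ∃; _×_; _,_; proj₁; proj₂)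
open import Data.Sum using (_⊎_; inj₁; inj₂; [_,_]′)
open import Function using (_∘_; id)
open import Function.Bundles using (_⇔_; mk⇔; Equivalence)
open import Function.Construct.Identity using (bijective)
open import Relation.Binary.Definitions using (DecidableEquality; tri<; tri≈; tri>)
open import Relation.Binary.PropositionalEquality
open import Relation.Nullary using (Dec; does; yes; no; ¬_; contradiction)
open import Relation.Nullary.Decidable using (dec-true; dec-false; does-⇔; decidable-stable; _×-dec_)
open import Algebra.Properties.CommutativeMonoid.Sum +-0-commutativeMonoid
  using (sum-syntax; sum-cong-≗; ∑-distrib-+; sum-replicate-zero)

-- Finite sums and counting

𝟙 : Bool → ℕ
𝟙 b = if b then 1 else 0

sum-allFin : ∀ {N} (h : Fin N → ℕ) → List.sum (map h (allFin N)) ≡ ∑[ i < N ] h i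
sum-allFin {zero}  h = refl
sum-allFin {suc N} h = cong (h fz +_) (begin
  List.sum (map h (tabulate fs))            ≡⟨ cong List.sum (map-tabulate fs h) ⟩
  List.sum (tabulate (h ∘ fs))              ≡⟨ cong List.sum (map-tabulate id (h ∘ fs)) ⟨
  List.sum (map (h ∘ fs) (allFin N))        ≡⟨ sum-allFin (h ∘ fs) ⟩
  ∑[ i < N ] h (fs i)                       ∎)
  where open ≡-Reasoning

∑-mono-≤ : ∀ {N} {f g : Fin N → ℕ} → (∀ i → f i ≤ g i) → ∑[ i < N ] f i ≤ ∑[ i < N ] g i
∑-mono-≤ {zero}  f≤g = z≤n
∑-mono-≤ {suc N} f≤g = +-mono-≤ (f≤g fz) (∑-mono-≤ (f≤g ∘ fs))

∑-const-1 : ∀ N → ∑[ i < N ] 1 ≡ N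
∑-const-1 zero    = refl
∑-const-1 (suc N) = cong suc (∑-const-1 N)

∑-zero : ∀ {N} {f : Fin N → ℕ} → (∀ i → f i ≡ 0) → ∑[ i < N ] f i ≡ 0
∑-zero {N} f≡0 = trans (sum-cong-≗ f≡0) (sum-replicate-zero N)

∑-single : ∀ {N} {f : Fin N → ℕ} i → (∀ j → j ≢ i → f j ≡ 0) → ∑[ j < N ] f j ≡ f i
∑-single {suc N} {f} fz     f≡0 = trans (cong (f fz +_) (∑-zero (λ j → f≡0 (fs j) λ ()))) (+-identityʳ _)
∑-single {suc N} {f} (fs i) f≡0 = cong₂ _+_ (f≡0 fz λ ()) (∑-single i λ j j≢i → f≡0 (fs j) (j≢i ∘ Finₚ.suc-injective))

term≤∑ : ∀ {N} (f : Fin N → ℕ) i → f i ≤ ∑[ j < N ] f j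
term≤∑ f fz     = m≤m+n _ _
term≤∑ f (fs i) = ≤-trans (term≤∑ (f ∘ fs) i) (m≤n+m _ (f fz))

two-terms≤∑ : ∀ {N} (f : Fin N → ℕ) {i j} → i ≢ j → f i + f j ≤ ∑[ k < N ] f k
two-terms≤∑ f {fz}   {fz}   i≢j = contradiction refl i≢j
two-terms≤∑ f {fz}   {fs j} _   = +-monoʳ-≤ (f fz) (term≤∑ (f ∘ fs) j)
two-terms≤∑ f {fs i} {fz}   _   = ≤-trans (≤-reflexive (+-comm (f (fs i)) (f fz))) (+-monoʳ-≤ (f fz) (term≤∑ (f ∘ fs) i))
two-terms≤∑ f {fs i} {fs j} i≢j = ≤-trans (two-terms≤∑ (f ∘ fs) (i≢j ∘ cong fs)) (m≤n+m _ (f fz))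

∑-positive : ∀ {N} (f : Fin N → ℕ) → 0 < ∑[ i < N ] f i → ∃ λ i → 0 < f i
∑-positive {suc N} f pos with f fz in eq
... | suc _ = fz , subst (0 <_) (sym eq) z<s
... | zero  = let i , fi>0 = ∑-positive (f ∘ fs) pos in fs i , fi>0

∑-+-≤ : ∀ {N} {f g h : Fin N → ℕ} → (∀ i → f i + g i ≤ h i) →
        ∑[ i < N ] f i + ∑[ i < N ] g i ≤ ∑[ i < N ] h i
∑-+-≤ {N} {f} {g} pointwise = ≤-trans (≤-reflexive (sym (∑-distrib-+ f g))) (∑-mono-≤ pointwise)

∑-≤-+ : ∀ {N} {f g h : Fin N → ℕ} → (∀ i → f i ≤ g i + h i) →
        ∑[ i < N ] f i ≤ ∑[ i < N ] g i + ∑[ i < N ] h i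
∑-≤-+ {N} {f} {g} {h} pointwise = ≤-trans (∑-mono-≤ pointwise) (≤-reflexive (∑-distrib-+ g h))

count≡∑ : ∀ {N} (P : Fin N → Bool) → count P ≡ ∑[ i < N ] 𝟙 (P i)
count≡∑ P = sum-allFin (𝟙 ∘ P)

_⊆_ : ∀ {N} → (Fin N → Bool) → (Fin N → Bool) → Set
P ⊆ Q = ∀ {i} → P i ≡ true → Q i ≡ true

⁅_⁆ : ∀ {N} → Fin N → Fin N → Bool
⁅ a ⁆ i = does (i ≟ a)

module _ {N : ℕ} {P Q : Fin N → Bool} where

  count-mono : P ⊆ Q → count P ≤ count Q
  count-mono P⊆Q = begin
    count P               ≡⟨ count≡∑ P ⟩
    ∑[ i < N ] 𝟙 (P i)    ≤⟨ ∑-mono-≤ (λ i → 𝟙-mono (P i) (Q i) P⊆Q) ⟩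
    ∑[ i < N ] 𝟙 (Q i)    ≡⟨ count≡∑ Q ⟨
    count Q               ∎
    where
    open ≤-Reasoning
    𝟙-mono : ∀ b c → (b ≡ true → c ≡ true) → 𝟙 b ≤ 𝟙 c
    𝟙-mono false c b⇒c = z≤n
    𝟙-mono true  c b⇒c rewrite b⇒c refl = ≤-refl

count-⁅⁆ : ∀ {N} (a : Fin N) → count ⁅ a ⁆ ≡ 1
count-⁅⁆ a = begin
  count ⁅ a ⁆              ≡⟨ count≡∑ ⁅ a ⁆ ⟩
  ∑[ i < _ ] 𝟙 (⁅ a ⁆ i)   ≡⟨ ∑-single a (λ j j≢a → cong 𝟙 (dec-false (j ≟ a) j≢a)) ⟩
  𝟙 (⁅ a ⁆ a)              ≡⟨ cong 𝟙 (dec-true (a ≟ a) refl) ⟩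
  1                        ∎
  where open ≡-Reasoning

module _ {N : ℕ} {P Q : Fin N → Bool} where

  count-⊆∪⁅⁆ : ∀ {a} → (∀ {i} → P i ≡ true → Q i ≡ true ⊎ i ≡ a) → count P ≤ suc (count Q)
  count-⊆∪⁅⁆ {a} P⊆Q∪a = begin
    count P                                      ≡⟨ count≡∑ P ⟩
    ∑[ i < N ] 𝟙 (P i)                           ≤⟨ ∑-≤-+ pointwise ⟩
    ∑[ i < N ] 𝟙 (Q i) + ∑[ i < N ] 𝟙 (⁅ a ⁆ i)  ≡⟨ cong₂ _+_ (count≡∑ Q) (count≡∑ ⁅ a ⁆) ⟨
    count Q + count ⁅ a ⁆                        ≡⟨ cong (count Q +_) (count-⁅⁆ a) ⟩
    count Q + 1                                  ≡⟨ +-comm (count Q) 1 ⟩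
    suc (count Q)                                ∎
    where
    open ≤-Reasoning
    pointwise : ∀ i → 𝟙 (P i) ≤ 𝟙 (Q i) + 𝟙 (⁅ a ⁆ i)
    pointwise i with P i in Pi | i ≟ a
    ... | false | _     = z≤n
    ... | true  | yes _ = m≤n+m 1 _
    ... | true  | no i≢a with P⊆Q∪a Pi
    ...   | inj₁ Qi   rewrite Qi = s≤s z≤n
    ...   | inj₂ i≡a  = contradiction i≡a i≢a

  count-mono-< : P ⊆ Q → ∀ {a} → Q a ≡ true → P a ≡ false → count P < count Q
  count-mono-< P⊆Q {a} Qa Pa = begin-strict
    count P                                      <⟨ m<m+n (count P) z<s ⟩
    count P + 1                                  ≡⟨ cong₂ _+_ (count≡∑ P) (trans (sym (count-⁅⁆ a)) (count≡∑ ⁅ a ⁆)) ⟩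
    ∑[ i < N ] 𝟙 (P i) + ∑[ i < N ] 𝟙 (⁅ a ⁆ i)  ≤⟨ ∑-+-≤ pointwise ⟩
    ∑[ i < N ] 𝟙 (Q i)                           ≡⟨ count≡∑ Q ⟨
    count Q                                      ∎
    where
    open ≤-Reasoning
    pointwise : ∀ i → 𝟙 (P i) + 𝟙 (⁅ a ⁆ i) ≤ 𝟙 (Q i)
    pointwise i with i ≟ a
    ... | yes refl rewrite Pa | Qa = ≤-refl
    ... | no _ with P i in Pi
    ...   | false = z≤n
    ...   | true  rewrite P⊆Q Pi = ≤-refl

  count-⊆-reverse : P ⊆ Q → count Q ≤ count P → Q ⊆ P
  count-⊆-reverse P⊆Q Q≤P {i} Qi with P i in Pi
  ... | true  = refl
  ... | false = contradiction Q≤P (<⇒≱ (count-mono-< P⊆Q Qi Pi))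

  count-disjoint : (∀ {i} → P i ≡ true → Q i ≡ true → ⊥) → count P + count Q ≤ N
  count-disjoint disjoint = begin
    count P + count Q                        ≡⟨ cong₂ _+_ (count≡∑ P) (count≡∑ Q) ⟩
    ∑[ i < N ] 𝟙 (P i) + ∑[ i < N ] 𝟙 (Q i)  ≤⟨ ∑-+-≤ pointwise ⟩
    ∑[ i < N ] 1                             ≡⟨ ∑-const-1 N ⟩
    N                                        ∎
    where
    open ≤-Reasoning
    pointwise : ∀ i → 𝟙 (P i) + 𝟙 (Q i) ≤ 1
    pointwise i with P i in Pi | Q i in Qi
    ... | true  | true  = ⊥-elim (disjoint Pi Qi)
    ... | true  | false = ≤-refl
    ... | false | true  = ≤-refl
    ... | false | false = z≤n

module _ {N : ℕ} (P : Fin N → Bool) where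

  count-witness : 0 < count P → ∃ λ i → P i ≡ true
  count-witness pos with ∑-positive (𝟙 ∘ P) (subst (0 <_) (count≡∑ P) pos)
  ... | i , Pi>0 with P i in Pi
  ...   | true  = i , Pi
  ...   | false = contradiction Pi>0 λ ()

  1≤count : ∀ a → P a ≡ true → 1 ≤ count P
  1≤count a Pa = begin
    1                    ≡⟨ cong 𝟙 Pa ⟨
    𝟙 (P a)              ≤⟨ term≤∑ (𝟙 ∘ P) a ⟩
    ∑[ i < N ] 𝟙 (P i)   ≡⟨ count≡∑ P ⟨
    count P              ∎
    where open ≤-Reasoning

  2≤count : ∀ {a b} → a ≢ b → P a ≡ true → P b ≡ true → 2 ≤ count P
  2≤count {a} {b} a≢b Pa Pb = begin
    2                    ≡⟨ cong₂ (λ x y → 𝟙 x + 𝟙 y) Pa Pb ⟨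
    𝟙 (P a) + 𝟙 (P b)    ≤⟨ two-terms≤∑ (𝟙 ∘ P) a≢b ⟩
    ∑[ i < N ] 𝟙 (P i)   ≡⟨ count≡∑ P ⟨
    count P              ∎
    where open ≤-Reasoning

_∖_ : ∀ {N} → (Fin N → Bool) → Fin N → Fin N → Bool
(P ∖ a) i = P i ∧ not (does (i ≟ a))

module _ {N : ℕ} (P : Fin N → Bool) {a : Fin N} where

  ∖-⊆ : (P ∖ a) ⊆ P
  ∖-⊆ {i} P∖a∋i with P i
  ... | true = refl

  ∖-∌ : (P ∖ a) a ≡ false
  ∖-∌ rewrite dec-true (a ≟ a) refl = ∧-zeroʳ (P a)

  ∈-∖ : ∀ {i} → P i ≡ true → i ≢ a → (P ∖ a) i ≡ true
  ∈-∖ {i} Pi i≢a rewrite Pi | dec-false (i ≟ a) i≢a = refl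

  ∖-≢ : ∀ {i} → (P ∖ a) i ≡ true → i ≢ a
  ∖-≢ a∈P∖a refl = contradiction (trans (sym a∈P∖a) (∖-∌)) λ ()

  ⊆-∖∪⁅⁆ : ∀ {i} → P i ≡ true → (P ∖ a) i ≡ true ⊎ i ≡ a
  ⊆-∖∪⁅⁆ {i} Pi with i ≟ a
  ... | yes i≡a = inj₂ i≡a
  ... | no  _ rewrite Pi = inj₁ refl

Reach-trans : ∀ {N} {G : Graph N} {i j k} → Reach G i j → Reach G j k → Reach G i k
Reach-trans here         q = q
Reach-trans (step ik p)  q = step ik (Reach-trans p q)

Reach-sym : ∀ {N} {G : Graph N} {i j} → Reach G i j → Reach G j i
Reach-sym         here                = here
Reach-sym {G = G} (step {i} {k} ik p) = Reach-trans (Reach-sym p) (step (trans (Graph.sym G k i) ik) here)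

reach-root⇒connected : ∀ {N} {G : Graph N} (r : Fin N) → (∀ u → Reach G u r) → Connected G
reach-root⇒connected r toRoot u v = Reach-trans (toRoot u) (Reach-sym (toRoot v))

walk-crosses : ∀ {N} {G : Graph N} {C : Set} (_≟ᶜ_ : DecidableEquality C) (κ : Fin N → C) {u v} →
               Reach G u v → κ u ≢ κ v → ∃ λ x → ∃ λ y → adj G x y ≡ true × κ x ≢ κ y
walk-crosses _≟ᶜ_ κ here κu≢κv = contradiction refl κu≢κv
walk-crosses _≟ᶜ_ κ {u} (step {k = k} uk walk) κu≢κv with κ u ≟ᶜ κ k
... | yes κu≡κk = walk-crosses _≟ᶜ_ κ walk (κu≢κv ∘ trans κu≡κk)
... | no  κu≢κk = u , k , uk , κu≢κk

-- A side of a bridge in a regular graph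

adj⇒≢ : ∀ {N} (G : Graph N) {u w} → adj G u w ≡ true → w ≢ u
adj⇒≢ G {u} uw refl = contradiction (trans (sym uw) (irrefl G u)) λ ()

module BridgeSide {N : ℕ} (G : Graph N) {d : ℕ} (regular : Regular G d)
  (X : Fin N → Bool) {x y : Fin N} (xy : adj G x y ≡ true) (x∈X : X x ≡ true) (y∉X : X y ≡ false)
  (only-exit : ∀ {u v} → adj G u v ≡ true → X u ≡ true → X v ≡ false → u ≡ x × v ≡ y) where

  interior-neighbours : ∀ {z} → X z ≡ true → z ≢ x → adj G z ⊆ (X ∖ z)
  interior-neighbours Xz z≢x zw =
    ∈-∖ X (¬-not λ Xw≡false → z≢x (proj₁ (only-exit zw Xz Xw≡false))) (adj⇒≢ G zw)

  x-neighbours : ∀ {w} → adj G x w ≡ true → (X ∖ x) w ≡ true ⊎ w ≡ y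
  x-neighbours {w} xw with X w Bool.≟ true
  ... | yes Xw   = inj₁ (∈-∖ X Xw (adj⇒≢ G xw))
  ... | no  Xw≢t = inj₂ (proj₂ (only-exit xw x∈X (¬-not Xw≢t)))

  d≤|X∖z| : ∀ {z} → X z ≡ true → z ≢ x → d ≤ count (X ∖ z)
  d≤|X∖z| {z} Xz z≢x = subst (_≤ count (X ∖ z)) (regular z) (count-mono {P = adj G z} (interior-neighbours Xz z≢x))

  |X∖z|<|X| : ∀ {z} → X z ≡ true → count (X ∖ z) < count X
  |X∖z|<|X| {z} Xz = count-mono-< {P = X ∖ z} (∖-⊆ X) Xz (∖-∌ X)

  interior-vertex : 2 ≤ d → ∃ λ z → X z ≡ true × z ≢ x
  interior-vertex 2≤d =
    let z , z∈X∖x = count-witness (X ∖ x) (s≤s⁻¹ (≤-trans 2≤d d≤1+|X∖x|))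
    in z , ∖-⊆ X z∈X∖x , ∖-≢ X z∈X∖x
    where
    d≤1+|X∖x| : d ≤ suc (count (X ∖ x))
    d≤1+|X∖x| = subst (_≤ _) (regular x) (count-⊆∪⁅⁆ x-neighbours)

  not-tight : count X ≢ suc d
  not-tight tight = <⇒≱ (n<1+n d) (begin
    suc d                  ≡⟨ tight ⟨
    count X                ≤⟨ count-⊆∪⁅⁆ (⊆-∖∪⁅⁆ X) ⟩
    suc (count (X ∖ x))    ≤⟨ count-mono-< X∖x⊆N[x] {y} xy (cong (_∧ not (does (y ≟ x))) y∉X) ⟩
    count (adj G x)        ≡⟨ regular x ⟩
    d                      ∎)
    where
    open ≤-Reasoning
    X∖x⊆N[x] : (X ∖ x) ⊆ adj G x
    X∖x⊆N[x] {z} z∈X∖x =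
      trans (Graph.sym G x z) (count-⊆-reverse (interior-neighbours Xz z≢x) |X∖z|≤d {x} (∈-∖ X x∈X (≢-sym z≢x)))
      where
      Xz : X z ≡ true
      Xz = ∖-⊆ X z∈X∖x
      z≢x : z ≢ x
      z≢x = ∖-≢ X z∈X∖x
      |X∖z|≤d : count (X ∖ z) ≤ count (adj G z)
      |X∖z|≤d = subst (count (X ∖ z) ≤_) (sym (regular z)) (s≤s⁻¹ (subst (count (X ∖ z) <_) tight (|X∖z|<|X| Xz)))

  bridge-side-size : 2 ≤ d → 2 + d ≤ count X
  bridge-side-size 2≤d =
    let z , Xz , z≢x = interior-vertex 2≤d
    in ≤∧≢⇒< (≤-trans (s≤s (d≤|X∖z| Xz z≢x)) (|X∖z|<|X| Xz)) (not-tight ∘ sym)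

-- Parities of labels and odd edges

labelParity : ∀ {N} → (Fin N → Fin N) → Fin N → Parity
labelParity f v = parity (label f v)

%2≡1-parity : ∀ n → does (n % 2 ℕ.≟ 1) ≡ does (parity n ℙ.≟ 1ℙ)
%2≡1-parity 0             = refl
%2≡1-parity 1             = refl
%2≡1-parity (suc (suc n)) = %2≡1-parity n

+≡1ℙ-≢ : ∀ p q → does (p ℙ.+ q ℙ.≟ 1ℙ) ≡ not (does (p ℙ.≟ q))
+≡1ℙ-≢ 0ℙ 0ℙ = refl
+≡1ℙ-≢ 0ℙ 1ℙ = refl
+≡1ℙ-≢ 1ℙ 0ℙ = refl
+≡1ℙ-≢ 1ℙ 1ℙ = refl

not-does⇔¬ : ∀ {A : Set} (A? : Dec A) → not (does A?) ≡ true ⇔ (¬ A)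
not-does⇔¬ (yes a)  = mk⇔ (λ ()) (λ ¬a → contradiction a ¬a)
not-does⇔¬ (no  ¬a) = mk⇔ (λ _ → ¬a) (λ _ → refl)

diffParity⇔≢ : ∀ {N} (f : Fin N → Fin N) u v →
               diffParity f u v ≡ true ⇔ labelParity f u ≢ labelParity f v
diffParity⇔≢ f u v =
  subst (λ d → d ≡ true ⇔ labelParity f u ≢ labelParity f v) (sym diffParity≡) (not-does⇔¬ (_ ℙ.≟ _))
  where
  a = label f u
  b = label f v
  diffParity≡ : diffParity f u v ≡ not (does (parity a ℙ.≟ parity b))
  diffParity≡ = begin
    does ((a + b) % 2 ℕ.≟ 1)              ≡⟨ %2≡1-parity (a + b) ⟩
    does (parity (a + b) ℙ.≟ 1ℙ)          ≡⟨ cong (λ p → does (p ℙ.≟ 1ℙ)) (ℙ.+-homo-+ a b) ⟩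
    does (parity a ℙ.+ parity b ℙ.≟ 1ℙ)   ≡⟨ +≡1ℙ-≢ (parity a) (parity b) ⟩
    not (does (parity a ℙ.≟ parity b))    ∎
    where open ≡-Reasoning

does-true⁻¹ : ∀ {A : Set} (A? : Dec A) → does A? ≡ true → A
does-true⁻¹ (yes a) _ = a

does-false⁻¹ : ∀ {A : Set} (A? : Dec A) → does A? ≡ false → ¬ A
does-false⁻¹ (no ¬a) _ = ¬a

∧-true⁻¹ : ∀ {x y} → x ∧ y ≡ true → x ≡ true × y ≡ true
∧-true⁻¹ {true} {true} _ = refl , refl

record OddEdge {N} (G : Graph N) (f : Fin N → Fin N) (u v : Fin N) : Set where
  constructor _,_
  field
    adjacent       : adj G u v ≡ true
    parities-differ : labelParity f u ≢ labelParity f v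

oddPair : ∀ {N} → Graph N → (Fin N → Fin N) → Fin N → Fin N → Bool
oddPair G f u v = does (toℕ u <? toℕ v) ∧ adj G u v ∧ diffParity f u v

module _ {N : ℕ} (G : Graph N) (f : Fin N → Fin N) where

  oddEdges≡∑ : oddEdges G f ≡ ∑[ u < N ] count (oddPair G f u)
  oddEdges≡∑ = sum-allFin (λ u → count (oddPair G f u))

  OddEdge-sym : ∀ {u v} → OddEdge G f u v → OddEdge G f v u
  OddEdge-sym {u} {v} (uv , u≢v) = trans (Graph.sym G v u) uv , ≢-sym u≢v

  oddPair-intro : ∀ {u v} → toℕ u < toℕ v → OddEdge G f u v → oddPair G f u v ≡ true
  oddPair-intro {u} {v} u<v (uv , u≢v)
    rewrite dec-true (toℕ u <? toℕ v) u<v | uv = Equivalence.from (diffParity⇔≢ f u v) u≢v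

  oddPair-elim : ∀ u v → oddPair G f u v ≡ true → toℕ u < toℕ v × OddEdge G f u v
  oddPair-elim u v p =
    let u<v , rest = ∧-true⁻¹ {does (toℕ u <? toℕ v)} p
        uv  , dp   = ∧-true⁻¹ {adj G u v} rest
    in <ᵇ⇒< (toℕ u) (toℕ v) (Equivalence.from T-≡ u<v) ,
       uv , Equivalence.to (diffParity⇔≢ f u v) dp

  oddPair-orient : ∀ {u v} → OddEdge G f u v → oddPair G f u v ≡ true ⊎ oddPair G f v u ≡ true
  oddPair-orient {u} {v} e with <-cmp (toℕ u) (toℕ v)
  ... | tri< u<v _ _ = inj₁ (oddPair-intro u<v e)
  ... | tri≈ _ u≡v _ = contradiction (Finₚ.toℕ-injective u≡v) (≢-sym (adj⇒≢ G (OddEdge.adjacent e)))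
  ... | tri> _ _ v<u = inj₂ (oddPair-intro v<u (OddEdge-sym e))

  row≤oddEdges : ∀ a → count (oddPair G f a) ≤ oddEdges G f
  row≤oddEdges a = subst (count (oddPair G f a) ≤_) (sym oddEdges≡∑) (term≤∑ (λ u → count (oddPair G f u)) a)

  1≤oddEdges : ∀ {u v} → OddEdge G f u v → 1 ≤ oddEdges G f
  1≤oddEdges {u} {v} e = [ oriented u v , oriented v u ]′ (oddPair-orient e)
    where
    oriented : ∀ a b → oddPair G f a b ≡ true → 1 ≤ oddEdges G f
    oriented a b p = ≤-trans (1≤count (oddPair G f a) b p) (row≤oddEdges a)

  oddEdges-witness : 1 ≤ oddEdges G f → ∃ λ u → ∃ λ v → OddEdge G f u v
  oddEdges-witness pos =
    let u , row>0 = ∑-positive (λ u → count (oddPair G f u)) (subst (1 ≤_) oddEdges≡∑ pos)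
        v , p     = count-witness (oddPair G f u) row>0
    in u , v , proj₂ (oddPair-elim u v p)

  2≤oddEdges : ∀ {a b a′ b′} → oddPair G f a b ≡ true → oddPair G f a′ b′ ≡ true →
               ¬ (a ≡ a′ × b ≡ b′) → 2 ≤ oddEdges G f
  2≤oddEdges {a} {b} {a′} {b′} p p′ distinct with a ≟ a′
  ... | yes refl = ≤-trans (2≤count (oddPair G f a) (λ b≡b′ → distinct (refl , b≡b′)) p p′) (row≤oddEdges a)
  ... | no  a≢a′ = begin
    2                                  ≤⟨ +-mono-≤ (1≤count (oddPair G f a) b p) (1≤count (oddPair G f a′) b′ p′) ⟩
    count (oddPair G f a) + count (oddPair G f a′)
                                       ≤⟨ two-terms≤∑ (λ u → count (oddPair G f u)) a≢a′ ⟩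
    ∑[ u < N ] count (oddPair G f u)   ≡⟨ oddEdges≡∑ ⟨
    oddEdges G f                       ∎
    where open ≤-Reasoning

  oddPair-unique : ∀ {a b a′ b′} → oddEdges G f ≡ 1 →
                   oddPair G f a b ≡ true → oddPair G f a′ b′ ≡ true → a ≡ a′ × b ≡ b′
  oddPair-unique {a} {b} {a′} {b′} one p p′ =
    decidable-stable ((a ≟ a′) ×-dec (b ≟ b′)) λ distinct →
      contradiction (subst (2 ≤_) one (2≤oddEdges {a} {b} {a′} {b′} p p′ distinct)) λ { (s≤s ()) }

  OddEdge-unique : ∀ {u v u′ v′} → oddEdges G f ≡ 1 → OddEdge G f u v → OddEdge G f u′ v′ →
                   (u ≡ u′ × v ≡ v′) ⊎ (u ≡ v′ × v ≡ u′)
  OddEdge-unique {u} {v} {u′} {v′} one e e′ with oddPair-orient e | oddPair-orient e′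
  ... | inj₁ p | inj₁ p′ = inj₁ (oddPair-unique {u} {v} {u′} {v′} one p p′)
  ... | inj₁ p | inj₂ p′ = inj₂ (oddPair-unique {u} {v} {v′} {u′} one p p′)
  ... | inj₂ p | inj₁ p′ = let v≡u′ , u≡v′ = oddPair-unique {v} {u} {u′} {v′} one p p′ in inj₂ (u≡v′ , v≡u′)
  ... | inj₂ p | inj₂ p′ = let v≡v′ , u≡u′ = oddPair-unique {v} {u} {v′} {u′} one p p′ in inj₁ (u≡u′ , v≡v′)

oddEdges≡1 : ∀ {N} (G : Graph N) (f : Fin N → Fin N) (a b : Fin N) → oddPair G f a b ≡ true →
             (∀ u v → oddPair G f u v ≡ true → u ≡ a × v ≡ b) → oddEdges G f ≡ 1
oddEdges≡1 {N} G f a b ab only = begin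
  oddEdges G f                       ≡⟨ oddEdges≡∑ G f ⟩
  ∑[ u < N ] count (oddPair G f u)   ≡⟨ ∑-single a (λ u u≢a → trans (count≡∑ (oddPair G f u))
                                          (∑-zero λ v → cong 𝟙 (¬-not (u≢a ∘ proj₁ ∘ only u v)))) ⟩
  count (oddPair G f a)              ≡⟨ count≡∑ (oddPair G f a) ⟩
  ∑[ v < N ] 𝟙 (oddPair G f a v)     ≡⟨ ∑-single b (λ v v≢b → cong 𝟙 (¬-not (v≢b ∘ proj₂ ∘ only a v))) ⟩
  𝟙 (oddPair G f a b)                ≡⟨ cong 𝟙 ab ⟩
  1                                  ∎
  where open ≡-Reasoning

connected⇒1≤oddEdges : ∀ {N} (G : Graph N) → 2 ≤ N → Connected G →
                       (f : Labelling N) → 1 ≤ oddEdges G (proj₁ f)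
connected⇒1≤oddEdges {N} G 2≤N connected (f , _ , surjective) =
  let x , y , xy , x≢y = walk-crosses ℙ._≟_ (labelParity f) (connected (labelled 0<N) (labelled 2≤N)) parities-differ
  in 1≤oddEdges G f (xy , x≢y)
  where
  0<N : 0 < N
  0<N = ≤-trans (s≤s z≤n) 2≤N
  labelled : ∀ {m} → m < N → Fin N
  labelled m<N = proj₁ (surjective (fromℕ< m<N))
  parity-labelled : ∀ {m} (m<N : m < N) → labelParity f (labelled m<N) ≡ parity (suc m)
  parity-labelled m<N =
    cong (parity ∘ suc) (trans (cong toℕ (proj₂ (surjective (fromℕ< m<N)) refl)) (Finₚ.toℕ-fromℕ< m<N))
  parities-differ : labelParity f (labelled 0<N) ≢ labelParity f (labelled 2≤N)
  parities-differ eq = contradiction (trans (sym (parity-labelled 0<N)) (trans eq (parity-labelled 2≤N))) λ ()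

-- The lower bound

sameParity : ∀ {N} → (Fin N → Fin N) → Fin N → Fin N → Bool
sameParity f x w = does (labelParity f w ℙ.≟ labelParity f x)

module _ {N : ℕ} (G : Graph N) {d : ℕ} (regular : Regular G d) (2≤d : 2 ≤ d)
         (f : Fin N → Fin N) (one : oddEdges G f ≡ 1) where

  parity-class-size : ∀ {x y} → OddEdge G f x y → 2 + d ≤ count (sameParity f x)
  parity-class-size {x} {y} e@(xy , x≢y) =
    BridgeSide.bridge-side-size G regular (sameParity f x) xy
      (dec-true (labelParity f x ℙ.≟ labelParity f x) refl)
      (dec-false (labelParity f y ℙ.≟ labelParity f x) (≢-sym x≢y)) only-exit 2≤d
    where
    only-exit : ∀ {u v} → adj G u v ≡ true → sameParity f x u ≡ true → sameParity f x v ≡ false → u ≡ x × v ≡ y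
    only-exit {u} {v} uv u∼x v≁x = [ id , (λ (u≡y , _) → contradiction (u≡y→x∼y u≡y) x≢y) ]′
                                 (OddEdge-unique G f one (uv , u≢v) e)
      where
      u≡x : labelParity f u ≡ labelParity f x
      u≡x = does-true⁻¹ (_ ℙ.≟ _) u∼x
      u≢v : labelParity f u ≢ labelParity f v
      u≢v u≡v = does-false⁻¹ (_ ℙ.≟ _) v≁x (trans (sym u≡v) u≡x)
      u≡y→x∼y : u ≡ y → labelParity f x ≡ labelParity f y
      u≡y→x∼y refl = sym u≡x

  order-lower-bound : (2 + d) + (2 + d) ≤ N
  order-lower-bound =
    let x , y , e = oddEdges-witness G f (≤-reflexive (sym one))
    in ≤-trans (+-mono-≤ (parity-class-size e) (parity-class-size (OddEdge-sym G f e)))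
               (count-disjoint λ {w} w∼x w∼y → OddEdge.parities-differ e
                 (trans (sym (does-true⁻¹ (labelParity f w ℙ.≟ labelParity f x) w∼x))
                        (does-true⁻¹ (labelParity f w ℙ.≟ labelParity f y) w∼y)))

-- The construction

double : ℕ → ℕ
double zero    = zero
double (suc n) = suc (suc (double n))

∑-pairs : ∀ M (h : ℕ → ℕ) →
          ∑[ l < double M ] h (toℕ l) ≡ ∑[ j < M ] (h (double (toℕ j)) + h (suc (double (toℕ j))))
∑-pairs zero    h = refl
∑-pairs (suc M) h = trans (sym (+-assoc (h 0) (h 1) _)) (cong (h 0 + h 1 +_) (∑-pairs M (h ∘ suc ∘ suc)))

order : ℕ → ℕ
order m = double (3 + double m)

⌊double/2⌋ : ∀ j → ⌊ double j /2⌋ ≡ j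
⌊double/2⌋ zero    = refl
⌊double/2⌋ (suc j) = cong suc (⌊double/2⌋ j)

⌊suc-double/2⌋ : ∀ j → ⌊ suc (double j) /2⌋ ≡ j
⌊suc-double/2⌋ zero    = refl
⌊suc-double/2⌋ (suc j) = cong suc (⌊suc-double/2⌋ j)

parity-double : ∀ j → parity (double j) ≡ 0ℙ
parity-double zero    = refl
parity-double (suc j) = parity-double j

parity-suc-double : ∀ j → parity (suc (double j)) ≡ 1ℙ
parity-suc-double zero    = refl
parity-suc-double (suc j) = parity-suc-double j

⌊/2⌋<-double : ∀ {k M} → k < double M → ⌊ k /2⌋ < M
⌊/2⌋<-double {zero}        {suc M} _ = z<s
⌊/2⌋<-double {suc zero}    {suc M} _ = z<s
⌊/2⌋<-double {suc (suc k)} {suc M} (s≤s (s≤s k<2M)) = s≤s (⌊/2⌋<-double k<2M)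

∑-≢ : ∀ {a m} → a < m → suc (∑[ t < m ] 𝟙 (not (a ≡ᵇ toℕ t))) ≡ m
∑-≢ {zero}  {suc m} _ = cong suc (∑-const-1 m)
∑-≢ {suc a} {suc m} (s≤s a<m) = cong suc (∑-≢ a<m)

double≡+ : ∀ n → double n ≡ n + n
double≡+ zero    = refl
double≡+ (suc n) = cong suc (trans (cong suc (double≡+ n)) (sym (+-suc n n)))

-- Vertex k of twinGraph lies in copy parity k at slot ⌊ k /2⌋.  Slots are grouped as
-- 0 | 1 | 2 | 3 4 | 5 6 | …; within a copy two slots are adjacent unless they share a group
-- or are slot 0 and slot 1 or 2 (exactly when group i + group j ≤ 2), so each copy is the
-- complement of the path 1 – 0 – 2 plus a perfect matching.  The copies meet only in the
-- edge between the two slot-0 vertices 0 and 1.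
group : ℕ → ℕ
group 0                   = 0
group 1                   = 1
group 2                   = 2
group (suc (suc (suc i))) = 3 + ⌊ i /2⌋

sideAdj : ℕ → ℕ → Bool
sideAdj i j = (2 <ᵇ group i + group j) ∧ not (group i ≡ᵇ group j)

bridgeAdj : ℕ → ℕ → Bool
bridgeAdj i j = (i ≡ᵇ 0) ∧ (j ≡ᵇ 0)

twinAdj : ℕ → ℕ → Bool
twinAdj k l = if does (parity k ℙ.≟ parity l) then sideAdj ⌊ k /2⌋ ⌊ l /2⌋ else bridgeAdj ⌊ k /2⌋ ⌊ l /2⌋

≡ᵇ-sym : ∀ m n → (m ≡ᵇ n) ≡ (n ≡ᵇ m)
≡ᵇ-sym m n = does-⇔ (mk⇔ sym sym) (m ℕ.≟ n) (n ℕ.≟ m)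

twinAdj-sym : ∀ k l → twinAdj k l ≡ twinAdj l k
twinAdj-sym k l
  rewrite does-⇔ (mk⇔ sym sym) (parity k ℙ.≟ parity l) (parity l ℙ.≟ parity k)
        | +-comm (group ⌊ k /2⌋) (group ⌊ l /2⌋)
        | ≡ᵇ-sym (group ⌊ k /2⌋) (group ⌊ l /2⌋)
        | Bool.∧-comm (⌊ k /2⌋ ≡ᵇ 0) (⌊ l /2⌋ ≡ᵇ 0) = refl

twinAdj-irrefl : ∀ k → twinAdj k k ≡ false
twinAdj-irrefl k
  rewrite dec-true (parity k ℙ.≟ parity k) refl
        | dec-true (group ⌊ k /2⌋ ℕ.≟ group ⌊ k /2⌋) refl = ∧-zeroʳ _

twinGraph : ∀ N → Graph N
twinGraph N = record
  { adj    = λ u v → twinAdj (toℕ u) (toℕ v)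
  ; sym    = λ u v → twinAdj-sym (toℕ u) (toℕ v)
  ; irrefl = λ u → twinAdj-irrefl (toℕ u)
  }

twinAdj-pair : ∀ k j → 𝟙 (twinAdj k (double j)) + 𝟙 (twinAdj k (suc (double j))) ≡
                       𝟙 (sideAdj ⌊ k /2⌋ j) + 𝟙 (bridgeAdj ⌊ k /2⌋ j)
twinAdj-pair k j
  rewrite parity-double j | parity-suc-double j | ⌊double/2⌋ j | ⌊suc-double/2⌋ j with parity k
... | 0ℙ = refl
... | 1ℙ = +-comm (𝟙 (bridgeAdj ⌊ k /2⌋ j)) (𝟙 (sideAdj ⌊ k /2⌋ j))

slotDegree : ℕ → ℕ → ℕ
slotDegree M i = ∑[ j < M ] (𝟙 (sideAdj i (toℕ j)) + 𝟙 (bridgeAdj i (toℕ j)))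

slotDegree-≡ : ∀ m i → i < 3 + double m → slotDegree (3 + double m) i ≡ suc (double m)
slotDegree-≡ m 0 _ = cong suc (∑-const-1 (double m))
slotDegree-≡ m 1 _ = cong suc (∑-const-1 (double m))
slotDegree-≡ m 2 _ = cong suc (∑-const-1 (double m))
slotDegree-≡ zero    (suc (suc (suc s))) (s≤s (s≤s (s≤s ())))
-- Slots 3 + 2t and 4 + 2t form group 3 + t, adjacent to slot 3 + s unless t = ⌊ s /2⌋.
slotDegree-≡ (suc m) (suc (suc (suc s))) (s≤s (s≤s (s≤s s<2m))) = cong (3 +_) (begin
  ∑[ t < double (suc m) ] φ (3 + toℕ t)                              ≡⟨ ∑-pairs (suc m) (φ ∘ (3 +_)) ⟩
  ∑[ t < suc m ] (φ (3 + double (toℕ t)) + φ (4 + double (toℕ t)))  ≡⟨ sum-cong-≗ {suc m} φ-pair ⟩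
  ∑[ t < suc m ] (c (toℕ t) + c (toℕ t))                            ≡⟨ ∑-distrib-+ {suc m} (c ∘ toℕ) (c ∘ toℕ) ⟩
  ∑[ t < suc m ] c (toℕ t) + ∑[ t < suc m ] c (toℕ t)               ≡⟨ cong₂ _+_ ∑c≡m ∑c≡m ⟩
  m + m                                                             ≡⟨ double≡+ m ⟨
  double m                                                          ∎)
  where
  open ≡-Reasoning
  a = ⌊ s /2⌋
  φ : ℕ → ℕ
  φ j = 𝟙 (sideAdj (3 + s) j) + 𝟙 (bridgeAdj (3 + s) j)
  c : ℕ → ℕ
  c t = 𝟙 (not (a ≡ᵇ t))
  φ-block : ∀ {x t} → ⌊ x /2⌋ ≡ t → φ (3 + x) ≡ c t
  φ-block refl = +-identityʳ _
  φ-pair : ∀ t → φ (3 + double (toℕ t)) + φ (4 + double (toℕ t)) ≡ c (toℕ t) + c (toℕ t)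
  φ-pair t = cong₂ _+_ (φ-block (⌊double/2⌋ (toℕ t))) (φ-block (⌊suc-double/2⌋ (toℕ t)))
  ∑c≡m : ∑[ t < suc m ] c (toℕ t) ≡ m
  ∑c≡m = suc-injective (∑-≢ (⌊/2⌋<-double s<2m))

twinGraph-regular : ∀ m → Regular (twinGraph (order m)) (suc (double m))
twinGraph-regular m u = begin
  degree (twinGraph (order m)) u                  ≡⟨ count≡∑ {double M} (twinAdj k ∘ toℕ) ⟩
  ∑[ l < double M ] 𝟙 (twinAdj k (toℕ l))         ≡⟨ ∑-pairs M (𝟙 ∘ twinAdj k) ⟩
  ∑[ j < M ] (𝟙 (twinAdj k (double (toℕ j))) + 𝟙 (twinAdj k (suc (double (toℕ j)))))
                                                  ≡⟨ sum-cong-≗ {M} (twinAdj-pair k ∘ toℕ) ⟩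
  slotDegree M ⌊ k /2⌋                            ≡⟨ slotDegree-≡ m ⌊ k /2⌋ (⌊/2⌋<-double (Finₚ.toℕ<n u)) ⟩
  suc (double m)                                  ∎
  where
  open ≡-Reasoning
  M = 3 + double m
  k = toℕ u

twinAdj-sameSide : ∀ {k l} → parity k ≡ parity l → twinAdj k l ≡ sideAdj ⌊ k /2⌋ ⌊ l /2⌋
twinAdj-sameSide {k} {l} k∼l rewrite dec-true (parity k ℙ.≟ parity l) k∼l = refl

twinGraph-connected : ∀ m → Connected (twinGraph (order (suc m)))
twinGraph-connected m = reach-root⇒connected fz toRoot
  where
  toRoot : ∀ u → Reach (twinGraph (order (suc m))) u fz
  toRoot fz                                   = here
  toRoot (fs fz)                              = step refl here
  toRoot (fs (fs fz))                         = step {k = # 6} refl (step refl here)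
  toRoot (fs (fs (fs fz)))                    = step {k = # 7} refl (step refl (toRoot (# 1)))
  toRoot (fs (fs (fs (fs fz))))               = step {k = # 6} refl (step refl here)
  toRoot (fs (fs (fs (fs (fs fz)))))          = step {k = # 7} refl (step refl (toRoot (# 1)))
  toRoot (fs (fs (fs (fs (fs (fs u)))))) with parity (toℕ u) in p
  ... | 0ℙ = step (twinAdj-sameSide {6 + toℕ u} {0} p) here
  ... | 1ℙ = step (twinAdj-sameSide {6 + toℕ u} {1} p) (toRoot (# 1))

twinAdj-otherSide : ∀ {k l} → parity k ≢ parity l → twinAdj k l ≡ bridgeAdj ⌊ k /2⌋ ⌊ l /2⌋
twinAdj-otherSide {k} {l} k≁l rewrite dec-false (parity k ℙ.≟ parity l) k≁l = refl

bridgeAdj-ends : ∀ {k l} → k < l → bridgeAdj ⌊ k /2⌋ ⌊ l /2⌋ ≡ true → k ≡ 0 × l ≡ 1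
bridgeAdj-ends {0}           {1}           _ _  = refl , refl
bridgeAdj-ends {0}           {suc (suc l)} _ ()
bridgeAdj-ends {1}           {suc (suc l)} _ ()
bridgeAdj-ends {suc (suc k)} {_}           _ ()
bridgeAdj-ends {1}           {0}           () _
bridgeAdj-ends {1}           {1}           (s≤s ()) _

twinAdj-oddEnds : ∀ {k l} → k < l → twinAdj k l ≡ true → parity (suc k) ≢ parity (suc l) → k ≡ 0 × l ≡ 1
twinAdj-oddEnds {k} {l} k<l kl k+1≁l+1 = bridgeAdj-ends k<l (trans (sym (twinAdj-otherSide {k} {l} k≁l)) kl)
  where
  k≁l : parity k ≢ parity l
  k≁l k∼l = k+1≁l+1 (ℙ.⁻¹-injective (trans (ℙ.suc-homo-⁻¹ k) (trans k∼l (sym (ℙ.suc-homo-⁻¹ l)))))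

twinGraph-oddEdges : ∀ m → oddEdges (twinGraph (order m)) id ≡ 1
twinGraph-oddEdges m = oddEdges≡1 (twinGraph (order m)) id fz (fs fz) refl only
  where
  only : ∀ u v → oddPair (twinGraph (order m)) id u v ≡ true → u ≡ fz × v ≡ fs fz
  only u v p =
    let u<v , uv , u≁v = oddPair-elim (twinGraph (order m)) id u v p
        u≡0 , v≡1 = twinAdj-oddEnds u<v uv u≁v
    in Finₚ.toℕ-injective u≡0 , Finₚ.toℕ-injective v≡1

double≡2* : ∀ n → double n ≡ 2 * n
double≡2* n = trans (double≡+ n) (cong (n +_) (sym (+-identityʳ n)))

order-double : ∀ n → order (double n) ≡ 8 * n + 6
order-double n = begin
  double (3 + double (double n))   ≡⟨ double≡2* _ ⟩
  2 * (3 + double (double n))      ≡⟨ cong (λ x → 2 * (3 + x)) (trans (double≡2* _) (cong (2 *_) (double≡2* n))) ⟩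
  2 * (3 + 2 * (2 * n))            ≡⟨ ring n ⟩
  8 * n + 6                        ∎
  where
  open ≡-Reasoning
  ring : ∀ n → 2 * (3 + 2 * (2 * n)) ≡ 8 * n + 6
  ring = solve-∀

suc-double-double : ∀ n → suc (double (double n)) ≡ 4 * n + 1
suc-double-double n = begin
  suc (double (double n))   ≡⟨ cong suc (trans (double≡2* _) (cong (2 *_) (double≡2* n))) ⟩
  suc (2 * (2 * n))         ≡⟨ ring n ⟩
  4 * n + 1                 ∎
  where
  open ≡-Reasoning
  ring : ∀ n → suc (2 * (2 * n)) ≡ 4 * n + 1
  ring = solve-∀

RnaOneGraph : ℕ → ℕ → Set
RnaOneGraph N d = Σ (Graph N) λ G → Connected G × Regular G d × RnaNumber G 1

twinGraph-rnaOne : ∀ m → RnaOneGraph (order (suc m)) (suc (double (suc m)))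
twinGraph-rnaOne m =
  G , twinGraph-connected m , twinGraph-regular (suc m) ,
  ((id , bijective _≡_) , twinGraph-oddEdges (suc m)) ,
  connected⇒1≤oddEdges G (s≤s (s≤s z≤n)) (twinGraph-connected m)
  where
  G = twinGraph (order (suc m))

theorem6p10 : (n : ℕ) → 1 ≤ n →
    (Σ (Graph (8 * n + 6)) (λ G → Connected G × Regular G (4 * n + 1) × RnaNumber G 1))
    × ((N : ℕ) (G : Graph N) → Connected G → Regular G (4 * n + 1) → RnaNumber G 1 →
       8 * n + 6 ≤ N)
theorem6p10 n@(suc k) 1≤n = extremal , minimal
  where
  extremal : RnaOneGraph (8 * n + 6) (4 * n + 1)
  extremal = subst₂ RnaOneGraph (order-double n) (suc-double-double n) (twinGraph-rnaOne (suc (double k)))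
  minimal : (N : ℕ) (G : Graph N) → Connected G → Regular G (4 * n + 1) → RnaNumber G 1 → 8 * n + 6 ≤ N
  minimal N G _ regular (((f , _) , one) , _) =
    subst (_≤ N) (bound-eq n) (order-lower-bound G regular 2≤d f one)
    where
    2≤d : 2 ≤ 4 * n + 1
    2≤d = ≤-trans (s≤s (s≤s z≤n)) (+-monoˡ-≤ 1 (*-monoʳ-≤ 4 1≤n))
    bound-eq : ∀ n → (2 + (4 * n + 1)) + (2 + (4 * n + 1)) ≡ 8 * n + 6
    bound-eq = solve-∀
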